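{- Let $(K,\le)$ be a weak abstract elementary class and $\mathscr A$ a notion of amalgamation on $K$, with associated independence relation $\downarrow$. (1) If $A\downarrow^N_M B$ and $N'\geq N$, then $A\downarrow^{N'}_M B$. (2) Suppose that $K$ admits finite intersections and $\mathscr A$ is regular and minimal. If $A\downarrow^N_M B$ and $N'\le N$ is such that $A,B,M\subseteq N'$, then $A\downarrow^{N'}_M B$.
   Context: Weak AEC: $K$ is a class of structures in a fixed language closed under isomorphism; $\le$ is a partial order on $K$ refining the substructure relation and invariant under isomorphisms; there is $\mathrm{LS}(K)$ with: for $N\in K$, $A\subseteq N$ there is $M\le N$, $A\subseteq M$, $|M|\le|A|+\mathrm{LS}(K)$; unions of $\le$-increasing continuous chains are in $K$ and $\ge$ each member; if $M_1,M_2\le N$ and $M_1\subseteq M_2$ then $M_1\le M_2$. A $K$-embedding $f:M\to N$ is an isomorphism onto $f[M]$ with $f[M]\le N$; $\iota$ denotes inclusions. Notion of amalgamation: for $M_0\le M_1$ and a $K$-embedding $f:M_0\to M_2$, an amalgam is $(N,g_1,g_2)$, $g_i:M_i\to N$ $K$-embeddings with $g_1\restriction M_0=g_2f$. $\mathscr A$ assigns to each $(M_0,M_1,M_2,f)$ a nonempty class $\mathscr A(M_0,M_1,M_2,f)$ of amalgams such that $(M_1,\iota,\mathrm{id})\in\mathscr A(M_0,M_0,M_1,\iota)$, and it is closed under: $(N,g_1,g_2)\mapsto(N',hg_1,hg_2)$ for $h:N\cong N'$; passing to $(N,g_1h^{ -1},g_2)\in\mathscr A(h[M_0],M',M_2,f(h\restriction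 M_0)^{ -1})$ for $h:M_1\cong M'$; to $(N,g_1,g_2h^{ -1})\in\mathscr A(M_0,M_1,M',hf)$ for $h:M_2\cong M'$; and to $(N,g_2,g_1)\in\mathscr A(f[M_0],M_2,M_1,f^{ -1})$. "$N$ is an $\mathscr A$-amalgam of $M_1,M_2$ over $M_0$ by inclusion" means $(N,\iota,\iota)\in\mathscr A(M_0,M_1,M_2,\iota)$; $M_1,M_2$ are $\mathscr A$-subamalgamated over $M_0$ inside $N$ if some $N'\le N$ is such an amalgam. Minimal: for $(N,g_1,g_2)\in\mathscr A(M_0,M_1,M_2,f)$, if $N'\le N$ and $g_1[M_1]\cup g_2[M_2]\subseteq N'$ then $N'=N$. Regular: for $M_0\le M_1$, $K$-embeddings $f:M_0\to M_2$, $g_i:M_i\to N$ with $g_1\restriction M_0=g_2f$, TFAE: (1) $(N,g_1,g_2)\in\mathscr A(M_0,M_1,M_2,f)$; (2) there are $M_0\le M'\le M_1$, $g_2[M_2]\le N'\le N$, $g_1[M']\subseteq N'$, with $(N',g_1\restriction M',g_2)\in\mathscr A(M_0,M',M_2,f)$ and $(N,g_1,\iota)\in\mathscr A(M',M_1,N',g_1\restriction M')$; (3) for every $M_0\le M'\le M_1$ there is $N'\le N$ with $(N',g_1\restriction M',g_2)\in\mathscr A(M_0,M',M_2,f)$, and for every such $N'$, $(N,g_1,\iota)\in\mathscr A(M',M_1,N',g_1\restriction M')$. $K$ admits finite intersections if whenever $M_0\le M_1,M_2\le N$, the intersection $M_1\cap M_2$ is (the universe of) a model in $K$. Independence: for $M\le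 N$ and $A,B\subseteq N$, $A\downarrow^N_M B$ means there are $M_1,M_2$ with $M\le M_1,M_2\le N$, $A\subseteq M_1$, $B\subseteq M_2$, and $M_1,M_2$ $\mathscr A$-subamalgamated over $M$ inside $N$. -}

module Defs where

import Level
open import Level using (0ℓ; Lift)
open import Data.Nat using (ℕ)
open import Data.Vec using (Vec; map)
open import Data.Vec.Relation.Unary.All using (All)
open import Data.Product using (Σ; Σ-syntax; _×_; proj₁)
open import Data.Sum using (_⊎_; inj₁; inj₂)
open import Data.Unit using (⊤)
open import Function using (_∘_; id)
open import Function.Bundles using (_⇔_)
open import Induction.WellFounded using (WellFounded)
open import Relation.Binary.PropositionalEquality using (_≡_)

record Language : Set₁ where
  field
    Fun   : Set
    fArity : Fun → ℕ
    Rel   : Set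
    rArity : Rel → ℕ

-- Structures: all structures live inside an ambient universe of
-- elements U (a type).  Only the values on the universe matter.

module Structures (L : Language) (U : Set) where
  open Language L

  Subset : Set₁
  Subset = U → Set

  _⊆_ : Subset → Subset → Set
  A ⊆ B = ∀ x → A x → B x

  _∩_ : Subset → Subset → Subset
  (A ∩ B) x = A x × B x

  _≡ₛ_ : Subset → Subset → Set
  A ≡ₛ B = (A ⊆ B) × (B ⊆ A)

  record Str : Set₁ where
    field
      dom    : Subset
      fun    : (f : Fun) → Vec U (fArity f) → U
      rel    : (r : Rel) → Vec U (rArity r) → Set
      closed : ∀ f (xs : Vec U (fArity f)) → All dom xs → dom (fun f xs)
  open Str public

  _⊆ₛ_ : Str → Str → Set
  M ⊆ₛ N =
    (dom M ⊆ dom N)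
    × (∀ f (xs : Vec U (fArity f)) → All (dom M) xs → fun M f xs ≡ fun N f xs)
    × (∀ r (xs : Vec U (rArity r)) → All (dom M) xs → rel M r xs ⇔ rel N r xs)

  _≐_ : Str → Str → Set
  M ≐ N = (M ⊆ₛ N) × (N ⊆ₛ M)

  record IsIsoWith (h hi : U → U) (M N : Str) : Set where
    field
      maps  : ∀ x → dom M x → dom N (h x)
      mapsi : ∀ y → dom N y → dom M (hi y)
      invˡ  : ∀ x → dom M x → hi (h x) ≡ x
      invʳ  : ∀ y → dom N y → h (hi y) ≡ y
      pfun  : ∀ f (xs : Vec U (fArity f)) → All (dom M) xs →
              h (fun M f xs) ≡ fun N f (map h xs)
      prel  : ∀ r (xs : Vec U (rArity r)) → All (dom M) xs →
              rel M r xs ⇔ rel N r (map h xs)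

  IsIso : (U → U) → Str → Str → Set
  IsIso h M N = Σ[ hi ∈ (U → U) ] IsIsoWith h hi M N

  -- |P| ≤ |Q| + |κ|  (injection, on underlying elements, into Q ⊎ κ)
  CardLe : Subset → Subset → Set → Set
  CardLe P Q κ =
    Σ[ e ∈ (Σ U P → U ⊎ κ) ]
      (∀ p → InQ (e p)) × (∀ p q → e p ≡ e q → proj₁ p ≡ proj₁ q)
    where
      InQ : U ⊎ κ → Set
      InQ (inj₁ u) = Q u
      InQ (inj₂ _) = ⊤

  -- well-orders (used as index sets of chains, i.e. ordinals)
  record WellOrder (I : Set) : Set₁ where
    field
      _<_     : I → I → Set
      <-trans : ∀ {i j k} → i < j → j < k → i < k
      tri     : ∀ i j → (i < j) ⊎ (i ≡ j) ⊎ (j < i)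
      wf      : WellFounded _<_

  IsLimit : {I : Set} → WellOrder I → I → Set
  IsLimit W j = (Σ[ i ∈ _ ] i < j) × (∀ i → i < j → Σ[ k ∈ _ ] (i < k) × (k < j))
    where open WellOrder W

record WeakAEC (L : Language) (U : Set) : Set₁ where
  open Structures L U
  field
    K      : Str → Set
    K-iso  : ∀ {h M N} → IsIso h M N → K M → K N
    _≤_    : Str → Str → Set
    ≤-K    : ∀ {M N} → M ≤ N → K M × K N
    ≤-sub  : ∀ {M N} → M ≤ N → M ⊆ₛ N
    ≤-refl : ∀ {M} → K M → M ≤ M
    ≤-trans : ∀ {M N P} → M ≤ N → N ≤ P → M ≤ P
    ≤-antisym : ∀ {M N} → M ≤ N → N ≤ M → M ≐ N
    ≤-iso  : ∀ {h M N M' N'} → IsIso h N N' → IsIso h M M' → M ≤ N → M' ≤ N'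
    -- Löwenheim–Skolem number (as a cardinal, i.e. a type)
    LS     : Set
    ls     : ∀ {N} (A : Subset) → K N → A ⊆ dom N →
             Σ[ M ∈ Str ] (M ≤ N) × (A ⊆ dom M) × CardLe (dom M) A LS
    -- unions of ≤-increasing continuous chains (indexed by a nonempty well-order)
    chain  : ∀ {I : Set} (W : WellOrder I) (i₀ : I) (M : I → Str) →
             (∀ i → K (M i)) →
             (∀ i j → WellOrder._<_ W i j → M i ≤ M j) →
             (∀ j → IsLimit W j →
                dom (M j) ≡ₛ (λ x → Σ[ i ∈ I ] WellOrder._<_ W i j × dom (M i) x)) →
             ∀ (N : Str) → dom N ≡ₛ (λ x → Σ[ i ∈ I ] dom (M i) x) →
             (∀ i → M i ⊆ₛ N) →
             K N × (∀ i → M i ≤ N)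
    coherence : ∀ {M₁ M₂ N} → M₁ ≤ N → M₂ ≤ N → dom M₁ ⊆ dom M₂ → M₁ ≤ M₂

module AEC {L : Language} {U : Set} (W : WeakAEC L U) where
  open Structures L U public
  open WeakAEC W public

  IsEmb : (U → U) → Str → Str → Set₁
  IsEmb f M N = Σ[ I ∈ Str ] IsIso f M I × (I ≤ N)

  IsAmalgam : Str → Str → Str → (U → U) → Str → (U → U) → (U → U) → Set₁
  IsAmalgam M₀ M₁ M₂ f N g₁ g₂ =
    K N × IsEmb g₁ M₁ N × IsEmb g₂ M₂ N × (∀ x → dom M₀ x → g₁ x ≡ g₂ (f x))

  -- A notion of amalgamation.  𝒜 M₀ M₁ M₂ f N g₁ g₂ means
  -- (N , g₁ , g₂) ∈ 𝒜(M₀ , M₁ , M₂ , f).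
  record NotionOfAmalgamation : Set₁ where
    field
      𝒜 : Str → Str → Str → (U → U) → Str → (U → U) → (U → U) → Set
      𝒜-amalgam : ∀ {M₀ M₁ M₂ f N g₁ g₂} → M₀ ≤ M₁ → IsEmb f M₀ M₂ →
                  𝒜 M₀ M₁ M₂ f N g₁ g₂ → IsAmalgam M₀ M₁ M₂ f N g₁ g₂
      𝒜-nonempty : ∀ {M₀ M₁ M₂ f} → M₀ ≤ M₁ → IsEmb f M₀ M₂ →
                   Σ[ N ∈ Str ] Σ[ g₁ ∈ (U → U) ] Σ[ g₂ ∈ (U → U) ] 𝒜 M₀ M₁ M₂ f N g₁ g₂
      𝒜-trivial : ∀ {M₀ M₁} → M₀ ≤ M₁ → 𝒜 M₀ M₀ M₁ id M₁ id id
      𝒜-isoN : ∀ {M₀ M₁ M₂ f N g₁ g₂ h N'} → 𝒜 M₀ M₁ M₂ f N g₁ g₂ →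
               IsIso h N N' → 𝒜 M₀ M₁ M₂ f N' (h ∘ g₁) (h ∘ g₂)
      𝒜-isoM₁ : ∀ {M₀ M₁ M₂ f N g₁ g₂ h hi M' M₀'} → 𝒜 M₀ M₁ M₂ f N g₁ g₂ →
                IsIsoWith h hi M₁ M' → IsIso h M₀ M₀' →
                𝒜 M₀' M' M₂ (f ∘ hi) N (g₁ ∘ hi) g₂
      𝒜-isoM₂ : ∀ {M₀ M₁ M₂ f N g₁ g₂ h hi M'} → 𝒜 M₀ M₁ M₂ f N g₁ g₂ →
                IsIsoWith h hi M₂ M' →
                𝒜 M₀ M₁ M' (h ∘ f) N g₁ (g₂ ∘ hi)
      𝒜-sym : ∀ {M₀ M₁ M₂ f N g₁ g₂ fi M₀'} → 𝒜 M₀ M₁ M₂ f N g₁ g₂ →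
              IsIsoWith f fi M₀ M₀' →
              𝒜 M₀' M₂ M₁ fi N g₂ g₁
      -- representation coherence: maps only matter on their domains,
      -- structures only up to equality of structures
      𝒜-resp : ∀ {M₀ M₁ M₂ f N g₁ g₂ M₀' M₁' M₂' f' N' g₁' g₂'} →
               𝒜 M₀ M₁ M₂ f N g₁ g₂ →
               M₀ ≐ M₀' → M₁ ≐ M₁' → M₂ ≐ M₂' → N ≐ N' →
               (∀ x → dom M₀ x → f x ≡ f' x) →
               (∀ x → dom M₁ x → g₁ x ≡ g₁' x) →
               (∀ x → dom M₂ x → g₂ x ≡ g₂' x) →
               𝒜 M₀' M₁' M₂' f' N' g₁' g₂'

  module _ (NA : NotionOfAmalgamation) where
    open NotionOfAmalgamation NA

    Minimal : Set₁
    Minimal = ∀ {M₀ M₁ M₂ f N g₁ g₂} → 𝒜 M₀ M₁ M₂ f N g₁ g₂ →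
              ∀ N' → N' ≤ N →
              (∀ x → dom M₁ x → dom N' (g₁ x)) →
              (∀ x → dom M₂ x → dom N' (g₂ x)) →
              N' ≐ N

    RegCond1 RegCond2 RegCond3 :
      Str → Str → Str → (U → U) → Str → (U → U) → (U → U) → Set₁
    RegCond1 M₀ M₁ M₂ f N g₁ g₂ = Lift (Level.suc 0ℓ) (𝒜 M₀ M₁ M₂ f N g₁ g₂)
    RegCond2 M₀ M₁ M₂ f N g₁ g₂ =
      Σ[ M' ∈ Str ] (M₀ ≤ M') × (M' ≤ M₁) ×
      Σ[ N' ∈ Str ] (Σ[ I ∈ Str ] IsIso g₂ M₂ I × (I ≤ N')) × (N' ≤ N) ×
        (∀ x → dom M' x → dom N' (g₁ x)) ×
        𝒜 M₀ M' M₂ f N' g₁ g₂ × 𝒜 M' M₁ N' g₁ N g₁ id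
    RegCond3 M₀ M₁ M₂ f N g₁ g₂ =
      ∀ M' → M₀ ≤ M' → M' ≤ M₁ →
        (Σ[ N' ∈ Str ] (N' ≤ N) × 𝒜 M₀ M' M₂ f N' g₁ g₂) ×
        (∀ N' → N' ≤ N → 𝒜 M₀ M' M₂ f N' g₁ g₂ → 𝒜 M' M₁ N' g₁ N g₁ id)

    Regular : Set₁
    Regular = ∀ {M₀ M₁ M₂ f N g₁ g₂} → M₀ ≤ M₁ → IsEmb f M₀ M₂ →
              IsEmb g₁ M₁ N → IsEmb g₂ M₂ N →
              (∀ x → dom M₀ x → g₁ x ≡ g₂ (f x)) →
              (RegCond1 M₀ M₁ M₂ f N g₁ g₂ ⇔ RegCond2 M₀ M₁ M₂ f N g₁ g₂)
              × (RegCond1 M₀ M₁ M₂ f N g₁ g₂ ⇔ RegCond3 M₀ M₁ M₂ f N g₁ g₂)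

    Subamalgamated : Str → Str → Str → Str → Set₁
    Subamalgamated M M₁ M₂ N = Σ[ N'' ∈ Str ] (N'' ≤ N) × 𝒜 M M₁ M₂ id N'' id id

    Indep : Subset → Str → Str → Subset → Set₁
    Indep A M N B =
      Σ[ M₁ ∈ Str ] Σ[ M₂ ∈ Str ]
        (M ≤ M₁) × (M ≤ M₂) × (M₁ ≤ N) × (M₂ ≤ N) ×
        (A ⊆ dom M₁) × (B ⊆ dom M₂) × Subamalgamated M M₁ M₂ N

  FiniteIntersections : Set₁
  FiniteIntersections = ∀ {M₀ M₁ M₂ N} → M₀ ≤ M₁ → M₀ ≤ M₂ → M₁ ≤ N → M₂ ≤ N →
    Σ[ I ∈ Str ] (dom I ≡ₛ (dom M₁ ∩ dom M₂)) × (I ≤ N)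

{-# OPTIONS --safe #-}
module Submission where

open import Defs
open import Data.Product using (Σ-syntax; _×_; _,_; proj₁; proj₂)
open import Function using (id)
open import Function.Bundles using (mk⇔; Equivalence)
open import Data.Vec.Properties using (map-id)
open import Level using (lift)
open import Relation.Binary.PropositionalEquality using (refl; sym; cong; subst)

-- Downward transfer: intersect the two witnesses M₁, M₂ with N'; regularity
-- lets the amalgam N'' of M₁, M₂ shrink to an amalgam N₂ ≤ N'' of the two
-- intersections, and minimality forces N₂ = N₂ ∩ N', so N₂ already lies
-- inside N'.

module _ {L : Language} {U : Set} (W : WeakAEC L U) where
  open AEC W

  id-isIsoWith : ∀ {M} → IsIsoWith id id M M
  id-isIsoWith {M} = record
    { maps  = λ _ p → p
    ; mapsi = λ _ p → p
    ; invˡ  = λ _ _ → refl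
    ; invʳ  = λ _ _ → refl
    ; pfun  = λ f xs _ → cong (fun M f) (sym (map-id xs))
    ; prel  = λ r xs _ → mk⇔ (subst (rel M r) (sym (map-id xs))) (subst (rel M r) (map-id xs))
    }

  ≤⇒isEmb-id : ∀ {M N} → M ≤ N → IsEmb id M N
  ≤⇒isEmb-id {M} M≤N = M , (id , id-isIsoWith) , M≤N

  isEmb-id⇒⊆ : ∀ {M N} → IsEmb id M N → dom M ⊆ dom N
  isEmb-id⇒⊆ (_ , (_ , iso) , I≤N) x x∈M = proj₁ (≤-sub I≤N) x (IsIsoWith.maps iso x x∈M)

  record Meet (M₁ M₂ N : Str) : Set₁ where
    field
      meet    : Str
      meet≤   : meet ≤ N
      meet≤ˡ  : meet ≤ M₁
      meet≤ʳ  : meet ≤ M₂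
      ⊆-meet  : ∀ {A} → A ⊆ dom M₁ → A ⊆ dom M₂ → A ⊆ dom meet

    ≤-meet : ∀ {S} → S ≤ N → dom S ⊆ dom M₁ → dom S ⊆ dom M₂ → S ≤ meet
    ≤-meet S≤N S⊆M₁ S⊆M₂ = coherence S≤N meet≤ (⊆-meet S⊆M₁ S⊆M₂)

  meet-of : FiniteIntersections → ∀ {M₀ M₁ M₂ N} →
            M₀ ≤ M₁ → M₀ ≤ M₂ → M₁ ≤ N → M₂ ≤ N → Meet M₁ M₂ N
  meet-of FI M₀≤M₁ M₀≤M₂ M₁≤N M₂≤N with FI M₀≤M₁ M₀≤M₂ M₁≤N M₂≤N
  ... | I , I≡M₁∩M₂ , I≤N = record
    { meet   = I
    ; meet≤  = I≤N
    ; meet≤ˡ = coherence I≤N M₁≤N (λ x x∈I → proj₁ (proj₁ I≡M₁∩M₂ x x∈I))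
    ; meet≤ʳ = coherence I≤N M₂≤N (λ x x∈I → proj₂ (proj₁ I≡M₁∩M₂ x x∈I))
    ; ⊆-meet = λ A⊆M₁ A⊆M₂ x x∈A → proj₂ I≡M₁∩M₂ x (A⊆M₁ x x∈A , A⊆M₂ x x∈A)
    }

  module _ (NA : NotionOfAmalgamation) where
    open NotionOfAmalgamation NA

    𝒜-⊆ : ∀ {M M₁ M₂ N} → M ≤ M₁ → M ≤ M₂ → 𝒜 M M₁ M₂ id N id id →
          (dom M₁ ⊆ dom N) × (dom M₂ ⊆ dom N)
    𝒜-⊆ M≤M₁ M≤M₂ a with 𝒜-amalgam M≤M₁ (≤⇒isEmb-id M≤M₂) a
    ... | _ , emb₁ , emb₂ , _ = isEmb-id⇒⊆ emb₁ , isEmb-id⇒⊆ emb₂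

    𝒜-restrictˡ : Regular NA → ∀ {M M₁ M₂ N M'} → M ≤ M₁ → M ≤ M₂ →
                  𝒜 M M₁ M₂ id N id id → M ≤ M' → M' ≤ M₁ →
                  Σ[ N' ∈ Str ] (N' ≤ N) × 𝒜 M M' M₂ id N' id id
    𝒜-restrictˡ reg {M} {M₁} {M₂} {N} M≤M₁ M≤M₂ a M≤M' M'≤M₁
      with 𝒜-amalgam M≤M₁ (≤⇒isEmb-id M≤M₂) a
    ... | _ , emb₁ , emb₂ , commutes =
      proj₁ (regCond3 _ M≤M' M'≤M₁)
      where
      regCond3 : RegCond3 NA M M₁ M₂ id N id id
      regCond3 = Equivalence.to (proj₂ (reg M≤M₁ (≤⇒isEmb-id M≤M₂) emb₁ emb₂ commutes)) (lift a)

    𝒜-restrictʳ : Regular NA → ∀ {M M₁ M₂ N M'} → M ≤ M₁ → M ≤ M₂ →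
                  𝒜 M M₁ M₂ id N id id → M ≤ M' → M' ≤ M₂ →
                  Σ[ N' ∈ Str ] (N' ≤ N) × 𝒜 M M₁ M' id N' id id
    𝒜-restrictʳ reg M≤M₁ M≤M₂ a M≤M' M'≤M₂
      with 𝒜-restrictˡ reg M≤M₂ M≤M₁ (𝒜-sym a id-isIsoWith) M≤M' M'≤M₂
    ... | N' , N'≤N , a' = N' , N'≤N , 𝒜-sym a' id-isIsoWith

    Subamalgamated-restrict : Regular NA → ∀ {M M₁ M₂ I₁ I₂ N} → M ≤ M₁ → M ≤ M₂ →
                              M ≤ I₁ → I₁ ≤ M₁ → M ≤ I₂ → I₂ ≤ M₂ →
                              Subamalgamated NA M M₁ M₂ N → Subamalgamated NA M I₁ I₂ N
    Subamalgamated-restrict reg M≤M₁ M≤M₂ M≤I₁ I₁≤M₁ M≤I₂ I₂≤M₂ (N₀ , N₀≤N , a₀)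
      with 𝒜-restrictˡ reg M≤M₁ M≤M₂ a₀ M≤I₁ I₁≤M₁
    ... | N₁ , N₁≤N₀ , a₁
      with 𝒜-restrictʳ reg M≤I₁ M≤M₂ a₁ M≤I₂ I₂≤M₂
    ... | N₂ , N₂≤N₁ , a₂ = N₂ , ≤-trans N₂≤N₁ (≤-trans N₁≤N₀ N₀≤N) , a₂

    Subamalgamated-inside : FiniteIntersections → Minimal NA → ∀ {M M₁ M₂ N N'} →
                            M ≤ M₁ → M ≤ M₂ → M₁ ≤ N' → M₂ ≤ N' → N' ≤ N →
                            Subamalgamated NA M M₁ M₂ N → Subamalgamated NA M M₁ M₂ N'
    Subamalgamated-inside FI min {M₁ = M₁} {M₂} {N} {N'} M≤M₁ M≤M₂ M₁≤N' M₂≤N' N'≤N (N₀ , N₀≤N , a) =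
      N₀ , coherence N₀≤N N'≤N N₀⊆N' , a
      where
      M₁⊆N₀ : dom M₁ ⊆ dom N₀
      M₁⊆N₀ = proj₁ (𝒜-⊆ M≤M₁ M≤M₂ a)
      M₂⊆N₀ : dom M₂ ⊆ dom N₀
      M₂⊆N₀ = proj₂ (𝒜-⊆ M≤M₁ M≤M₂ a)
      M₁≤N : M₁ ≤ N
      M₁≤N = ≤-trans M₁≤N' N'≤N
      J : Meet N₀ N' N
      J = meet-of FI (coherence M₁≤N N₀≤N M₁⊆N₀) M₁≤N' N₀≤N N'≤N
      open Meet J
      J≐N₀ : meet ≐ N₀
      J≐N₀ = min a meet meet≤ˡ
        (⊆-meet M₁⊆N₀ (proj₁ (≤-sub M₁≤N')))
        (⊆-meet M₂⊆N₀ (proj₁ (≤-sub M₂≤N')))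
      N₀⊆N' : dom N₀ ⊆ dom N'
      N₀⊆N' x x∈N₀ = proj₁ (≤-sub meet≤ʳ) x (proj₁ (proj₂ J≐N₀) x x∈N₀)

    Indep-upward : ∀ {A B M N N'} → Indep NA A M N B → N ≤ N' → Indep NA A M N' B
    Indep-upward (M₁ , M₂ , M≤M₁ , M≤M₂ , M₁≤N , M₂≤N , A⊆M₁ , B⊆M₂ , N₀ , N₀≤N , a) N≤N' =
      M₁ , M₂ , M≤M₁ , M≤M₂ , ≤-trans M₁≤N N≤N' , ≤-trans M₂≤N N≤N' , A⊆M₁ , B⊆M₂ ,
      N₀ , ≤-trans N₀≤N N≤N' , a

    Indep-downward : FiniteIntersections → Regular NA → Minimal NA → ∀ {A B M N N'} →
                     Indep NA A M N B → N' ≤ N →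
                     A ⊆ dom N' → B ⊆ dom N' → dom M ⊆ dom N' → Indep NA A M N' B
    Indep-downward FI reg min {M = M} {N} {N'}
      (M₁ , M₂ , M≤M₁ , M≤M₂ , M₁≤N , M₂≤N , A⊆M₁ , B⊆M₂ , sub) N'≤N A⊆N' B⊆N' M⊆N' =
      I₁.meet , I₂.meet , M≤I₁ , M≤I₂ , I₁.meet≤ʳ , I₂.meet≤ʳ ,
      I₁.⊆-meet A⊆M₁ A⊆N' , I₂.⊆-meet B⊆M₂ B⊆N' ,
      Subamalgamated-inside FI min M≤I₁ M≤I₂ I₁.meet≤ʳ I₂.meet≤ʳ N'≤N
        (Subamalgamated-restrict reg M≤M₁ M≤M₂ M≤I₁ I₁.meet≤ˡ M≤I₂ I₂.meet≤ˡ sub)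
      where
      M≤N : M ≤ N
      M≤N = ≤-trans M≤M₁ M₁≤N
      M≤N' : M ≤ N'
      M≤N' = coherence M≤N N'≤N M⊆N'
      module I₁ = Meet (meet-of FI M≤M₁ M≤N' M₁≤N N'≤N)
      module I₂ = Meet (meet-of FI M≤M₂ M≤N' M₂≤N N'≤N)
      M≤I₁ : M ≤ I₁.meet
      M≤I₁ = I₁.≤-meet M≤N (proj₁ (≤-sub M≤M₁)) M⊆N'
      M≤I₂ : M ≤ I₂.meet
      M≤I₂ = I₂.≤-meet M≤N (proj₁ (≤-sub M≤M₂)) M⊆N'

proposition5p2 : ∀ (L : Language) (U : Set) (W : WeakAEC L U)
    (NA : AEC.NotionOfAmalgamation W) → let open AEC W in
    (∀ (A B : Subset) (M N N' : Str) → M ≤ N → A ⊆ dom N → B ⊆ dom N →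
       Indep NA A M N B → N ≤ N' → Indep NA A M N' B)
    ×
    (FiniteIntersections → Regular NA → Minimal NA →
     ∀ (A B : Subset) (M N N' : Str) → M ≤ N → A ⊆ dom N → B ⊆ dom N →
       Indep NA A M N B → N' ≤ N →
       A ⊆ dom N' → B ⊆ dom N' → dom M ⊆ dom N' → Indep NA A M N' B)
proposition5p2 L U W NA =
  (λ _ _ _ _ _ _ _ _ → Indep-upward W NA) ,
  (λ FI reg min _ _ _ _ _ _ _ _ → Indep-downward W NA FI reg min)
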